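{- Let $G$ be a graph, let $\nabla_1\ge\nabla_1(G)$ be an integer, let $\nabla_0$ be an integer with $\nabla_0(G)\le\nabla_0\le\nabla_1$, let $\nabla$ be an integer with $\nabla_1^B(G)<\nabla\le\nabla_1+1$, and set $\kappa=\max\{2\nabla_0,2\nabla\}$, $\lambda=1/\kappa$, $\mu=2\kappa^2$, $\nu=2\kappa^3$. Let $W\subseteq V(G)$ with $|W|\ge\nu$ and let $Z$ be a set of $\kappa$ vertices of $G$ that dominates $W$ (i.e. $W\subseteq N[Z]$). Then there exist an ordering $z_1,\ldots,z_\kappa$ of the vertices of $Z$ and an integer $m\le\kappa$ such that $(z_1,\ldots,z_m)$ is a pseudo-cover of $W$ (with parameters $\kappa,\lambda,\mu,\nu$).
   Context: Graphs are finite, undirected and simple; $N[v]$ is the closed neighborhood, $N[A]=\bigcup_{v\in A}N[v]$. $\nabla_0(G)=\max\{|E(H)|/|V(H)|: H\subseteq G\}$; $\nabla_1(G)$ is the maximum of $|E(H)|/|V(H)|$ over $1$-shallow minors $H$ of $G$ (minors whose branch sets induce connected subgraphs of radius at most $1$), and $\nabla_1^B(G)$ the same maximum over bipartite $1$-shallow minors. A vertex $z$ is $\lambda$-strong for a set $W$ if $|N[z]\cap W|\ge\lambda|W|$. A pseudo-cover of $W\subseteq V(G)$ (with parameters $\kappa,\lambda,\mu,\nu$) is a sequence $(v_1,\ldots,v_m)$ of vertices such that $m\le\kappa$; for every $i\le m$, $v_i$ is $\lambda$-strong for $W\setminus\bigcup_{j<i}N[v_j]$ and $|N[v_i]\cap(W\setminus\bigcup_{j<i}N[v_j])|\ge\mu$;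 and $|W\setminus\bigcup_{j\le m}N[v_j]|\le\nu$. -}

module Defs where

open import Data.Nat using (ℕ; zero; suc; _+_; _*_; _≤_; _<_; _⊔_; _^_)
open import Data.Bool using (Bool; true; false; _∧_; _∨_)
open import Data.Fin using (Fin)
open import Data.Fin.Properties using (_≟_; _<?_)
open import Data.Fin.Subset using (Subset; _∈_; _∩_; _─_; ∣_∣)
open import Data.Vec using (Vec; tabulate; sum)
open import Data.List using (List; []; _∷_; length)
open import Data.Product using (Σ; _×_; ∃)
open import Relation.Binary.PropositionalEquality using (_≡_; _≢_)
open import Relation.Nullary.Decidable using (⌊_⌋)
open import Function.Definitions using (Injective)

record Graph (n : ℕ) : Set where
  field
    adj    : Fin n → Fin n → Bool
    sym    : ∀ u v → adj u v ≡ adj v u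
    irrefl : ∀ v → adj v v ≡ false
open Graph public

edgeCount : ∀ {m} → Graph m → ℕ
edgeCount H = sum (tabulate λ u → ∣ tabulate (λ v → ⌊ u <? v ⌋ ∧ adj H u v) ∣)

N[_]_ : ∀ {n} → Fin n → Graph n → Subset n
N[ v ] G = tabulate λ u → ⌊ u ≟ v ⌋ ∨ adj G v u

Dominates : ∀ {n} → Graph n → Subset n → Subset n → Set
Dominates G Z W = ∀ w → w ∈ W → ∃ λ z → z ∈ Z × w ∈ (N[ z ] G)

IsSubgraphVia : ∀ {m n} → Graph m → Graph n → (Fin m → Fin n) → Set
IsSubgraphVia H G f =
  Injective _≡_ _≡_ f × (∀ u v → adj H u v ≡ true → adj G (f u) (f v) ≡ true)

Nabla0≤ : ∀ {n} → Graph n → ℕ → Set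
Nabla0≤ {n} G d = ∀ m (H : Graph m) (f : Fin m → Fin n) →
  IsSubgraphVia H G f → edgeCount H ≤ d * m

-- 1-shallow minor model of H in G: disjoint branch sets B i, each inducing a
-- connected subgraph of radius ≤ 1 (a centre c i ∈ B i with B i ⊆ N[c i]),
-- and every edge ij of H realised by an edge of G between B i and B j.
record ShallowMinor1 {m n : ℕ} (H : Graph m) (G : Graph n) : Set where
  field
    branch   : Fin m → Subset n
    centre   : Fin m → Fin n
    disjoint : ∀ i j v → v ∈ branch i → v ∈ branch j → i ≡ j
    centre∈  : ∀ i → centre i ∈ branch i
    radius1  : ∀ i v → v ∈ branch i → v ∈ (N[ centre i ] G)
    edges    : ∀ i j → adj H i j ≡ true →
               ∃ λ u → ∃ λ v → u ∈ branch i × v ∈ branch j × adj G u v ≡ true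

Bipartite : ∀ {m} → Graph m → Set
Bipartite {m} H = Σ (Fin m → Bool) λ c → ∀ u v → adj H u v ≡ true → c u ≢ c v

Nabla1≤ : ∀ {n} → Graph n → ℕ → Set
Nabla1≤ G d = ∀ m (H : Graph m) → ShallowMinor1 H G → edgeCount H ≤ d * m

-- nabla1^B(G) < d  (max over the finitely many nonempty bipartite 1-shallow minors)
Nabla1B< : ∀ {n} → Graph n → ℕ → Set
Nabla1B< G d = ∀ m (H : Graph m) → 0 < m → Bipartite H → ShallowMinor1 H G →
  edgeCount H < d * m

-- z is λ-strong for W, with λ = a / b given as a fraction (b > 0):
-- |N[z] ∩ W| ≥ (a/b) |W|, i.e. a |W| ≤ b |N[z] ∩ W|
Strong : ∀ {n} → Graph n → (a b : ℕ) → Fin n → Subset n → Set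
Strong G a b z W = a * ∣ W ∣ ≤ b * ∣ (N[ z ] G) ∩ W ∣

-- conditions on the sequence, with R the currently uncovered part of W
PCAux : ∀ {n} → Graph n → (a b μ ν : ℕ) → Subset n → List (Fin n) → Set
PCAux G a b μ ν R []       = ∣ R ∣ ≤ ν
PCAux G a b μ ν R (v ∷ vs) =
  Strong G a b v R × μ ≤ ∣ (N[ v ] G) ∩ R ∣ × PCAux G a b μ ν (R ─ (N[ v ] G)) vs

PseudoCover : ∀ {n} → Graph n → (κ a b μ ν : ℕ) → Subset n → List (Fin n) → Set
PseudoCover G κ a b μ ν W vs = length vs ≤ κ × PCAux G a b μ ν W vs

-- Order Z greedily: repeatedly take a vertex of Z dominating the most still uncovered vertices
-- of W, and stop once at most ν of them remain. Since the at most κ unused vertices of Z dominate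
-- the uncovered set R, the best of them dominates at least |R|/κ of it, so it is 1/κ-strong; and
-- while |R| > ν ≥ κμ this share is at least μ. The chosen vertices, followed by the rest of Z,
-- give the ordering.
module Submission where

open import Defs
open import Data.Nat using (ℕ; _+_; _*_; _≤_; _<_; _⊔_; _^_)
open import Data.Fin using (Fin; toℕ)
open import Data.Fin.Subset using (Subset; _∈_; ∣_∣)
open import Data.List using (List; take; tabulate)
open import Data.Product using (Σ; _×_; ∃)
open import Function.Bundles using (_⇔_)
open import Function.Definitions using (Injective)
open import Relation.Binary.PropositionalEquality using (_≡_)

open import Algebra.Properties.CommutativeSemigroup using (x∙yz≈y∙xz)
open import Data.Bool using (true; false)
open import Data.Empty using (⊥-elim)
open import Data.Fin using (zero; suc)
import Data.Fin.Properties as Finₚ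
open import Data.Fin.Subset using (_∩_; _─_; _∉_; Empty)
open import Data.Fin.Subset.Properties
  using (p─q⊆p; x∈p∩q⁺; x∈p∩q⁻; p⊆q⇒∣p∣≤∣q∣; Empty-unique; ∣⊥∣≡0)
open import Data.List using ([]; _∷_; _++_; length; map; lookup)
open import Data.List.Extrema.Nat using (argmax; argmax-sel; f[⊥]≤f[argmax]; f[xs]≤f[argmax])
open import Data.List.Membership.Propositional using () renaming (_∈_ to _∈ₗ_)
open import Data.List.Membership.Propositional.Properties
  using (∈-∃++; ∈-map⁺; ∈-map⁻; ∈-lookup)
open import Data.List.Properties using (length-map; length-take; tabulate-lookup)
open import Data.List.Relation.Binary.Permutation.Propositional
  using (_↭_; ↭-refl; ↭-sym; ↭-trans; prep; ↭⇒↭ₛ)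
open import Data.List.Relation.Binary.Permutation.Propositional.Properties
  using (shift; ↭-length; ∈-resp-↭)
import Data.List.Relation.Binary.Permutation.Setoid.Properties as Setoid↭
open import Data.List.Relation.Unary.All using (All; []; _∷_)
import Data.List.Relation.Unary.All as All
open import Data.List.Relation.Unary.AllPairs using ([]; _∷_)
open import Data.List.Relation.Unary.Any using (here; there; index)
open import Data.List.Relation.Unary.Any.Properties using (lookup-index)
open import Data.List.Relation.Unary.Unique.Propositional using (Unique)
open import Data.List.Relation.Unary.Unique.Propositional.Properties using (map⁺)
open import Data.Nat using (zero; suc; z≤n; s≤s; _≤?_)
open import Data.Vec using ([]; _∷_; here; there)
open import Data.Nat.ListAction using (sum)
open import Data.Nat.Properties
open import Data.Product using (_,_; ∃₂)
open import Data.Sum using (inj₁; inj₂)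
open import Function.Bundles using (mk⇔)
import Function.Properties.Equivalence as ⇔
open import Relation.Binary.PropositionalEquality
  using (_≢_; refl; trans; cong; subst; setoid)
import Relation.Binary.PropositionalEquality as ≡
open import Relation.Nullary using (yes; no; contradiction)

private
  variable
    n : ℕ
    A : Set

x∈p─q⇒x∉q : ∀ {x : Fin n} (p q : Subset n) → x ∈ p ─ q → x ∉ q
x∈p─q⇒x∉q (_ ∷ p) (true  ∷ q) (there x∈) (there x∈q) = x∈p─q⇒x∉q p q x∈ x∈q
x∈p─q⇒x∉q (_ ∷ p) (false ∷ q) (there x∈) (there x∈q) = x∈p─q⇒x∉q p q x∈ x∈q

∣p∣≤∣q∩p∣+∣p─q∣ : (p q : Subset n) → ∣ p ∣ ≤ ∣ q ∩ p ∣ + ∣ p ─ q ∣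
∣p∣≤∣q∩p∣+∣p─q∣ []          []          = z≤n
∣p∣≤∣q∩p∣+∣p─q∣ (true  ∷ p) (true  ∷ q) = s≤s (∣p∣≤∣q∩p∣+∣p─q∣ p q)
∣p∣≤∣q∩p∣+∣p─q∣ (true  ∷ p) (false ∷ q) =
  ≤-trans (s≤s (∣p∣≤∣q∩p∣+∣p─q∣ p q)) (≤-reflexive (≡.sym (+-suc ∣ q ∩ p ∣ ∣ p ─ q ∣)))
∣p∣≤∣q∩p∣+∣p─q∣ (false ∷ p) (true  ∷ q) = ∣p∣≤∣q∩p∣+∣p─q∣ p q
∣p∣≤∣q∩p∣+∣p─q∣ (false ∷ p) (false ∷ q) = ∣p∣≤∣q∩p∣+∣p─q∣ p q

∣r∩[p─q]∣≤∣r∩p∣ : (r p q : Subset n) → ∣ r ∩ (p ─ q) ∣ ≤ ∣ r ∩ p ∣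
∣r∩[p─q]∣≤∣r∩p∣ r p q = p⊆q⇒∣p∣≤∣q∣ λ x∈ →
  let x∈r , x∈p─q = x∈p∩q⁻ r (p ─ q) x∈ in x∈p∩q⁺ (x∈r , p─q⊆p p q x∈p─q)

elements : Subset n → List (Fin n)
elements []          = []
elements (true  ∷ p) = zero ∷ map suc (elements p)
elements (false ∷ p) = map suc (elements p)

length-elements : (p : Subset n) → length (elements p) ≡ ∣ p ∣
length-elements []          = refl
length-elements (true  ∷ p) = cong suc (trans (length-map suc (elements p)) (length-elements p))
length-elements (false ∷ p) = trans (length-map suc (elements p)) (length-elements p)

∈-elements⁺ : ∀ {x : Fin n} (p : Subset n) → x ∈ p → x ∈ₗ elements p
∈-elements⁺ (true  ∷ p) here       = here refl
∈-elements⁺ (true  ∷ p) (there x∈) = there (∈-map⁺ suc (∈-elements⁺ p x∈))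
∈-elements⁺ (false ∷ p) (there x∈) = ∈-map⁺ suc (∈-elements⁺ p x∈)

∈-elements⁻ : ∀ {x : Fin n} (p : Subset n) → x ∈ₗ elements p → x ∈ p
∈-elements⁻ (true ∷ p) (here refl) = here
∈-elements⁻ (true ∷ p) (there x∈) with ∈-map⁻ suc x∈
... | _ , y∈ , refl = there (∈-elements⁻ p y∈)
∈-elements⁻ (false ∷ p) x∈ with ∈-map⁻ suc x∈
... | _ , y∈ , refl = there (∈-elements⁻ p y∈)

∈-elements : ∀ {x : Fin n} (p : Subset n) → (x ∈ p) ⇔ (x ∈ₗ elements p)
∈-elements p = mk⇔ (∈-elements⁺ p) (∈-elements⁻ p)

elements-unique : (p : Subset n) → Unique (elements p)
elements-unique []          = []
elements-unique (true  ∷ p) =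
  All.tabulate zero∉ ∷ map⁺ Finₚ.suc-injective (elements-unique p)
  where
  zero∉ : ∀ {x} → x ∈ₗ map suc (elements p) → zero ≢ x
  zero∉ x∈ refl with ∈-map⁻ suc x∈
  ... | _ , _ , ()
elements-unique (false ∷ p) = map⁺ Finₚ.suc-injective (elements-unique p)

sum-map-mono-≤ : ∀ {f g : A → ℕ} → (∀ x → f x ≤ g x) → ∀ xs → sum (map f xs) ≤ sum (map g xs)
sum-map-mono-≤ f≤g []       = z≤n
sum-map-mono-≤ f≤g (x ∷ xs) = +-mono-≤ (f≤g x) (sum-map-mono-≤ f≤g xs)

sum-map-≤-length* : ∀ {f : A → ℕ} {c xs} → All (λ x → f x ≤ c) xs → sum (map f xs) ≤ length xs * c
sum-map-≤-length* []           = z≤n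
sum-map-≤-length* (fx≤c ∷ fxs≤c) = +-mono-≤ fx≤c (sum-map-≤-length* fxs≤c)

argmax∈ : ∀ (f : A → ℕ) x xs → argmax f x xs ∈ₗ x ∷ xs
argmax∈ f x xs with argmax-sel f x xs
... | inj₁ argmax≡x  = here argmax≡x
... | inj₂ argmax∈xs = there argmax∈xs

sum-map-≤-length*argmax : ∀ (f : A → ℕ) x xs →
  sum (map f (x ∷ xs)) ≤ length (x ∷ xs) * f (argmax f x xs)
sum-map-≤-length*argmax f x xs =
  sum-map-≤-length* (f[⊥]≤f[argmax] {f = f} x xs ∷ f[xs]≤f[argmax] {f = f} x xs)

∈⇒↭∷ : ∀ {x : A} {xs} → x ∈ₗ xs → ∃ λ ys → xs ↭ x ∷ ys
∈⇒↭∷ {x = x} x∈xs with ys , zs , refl ← ∈-∃++ x∈xs = ys ++ zs , shift x ys zs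

∈-resp-↭⇔ : ∀ {x : A} {xs ys} → xs ↭ ys → (x ∈ₗ xs) ⇔ (x ∈ₗ ys)
∈-resp-↭⇔ xs↭ys = mk⇔ (∈-resp-↭ xs↭ys) (∈-resp-↭ (↭-sym xs↭ys))

Unique-resp-↭ : ∀ {xs ys : List A} → xs ↭ ys → Unique xs → Unique ys
Unique-resp-↭ xs↭ys = Setoid↭.Unique-resp-↭ (setoid _) (↭⇒↭ₛ xs↭ys)

lookup-injective : ∀ {xs : List A} → Unique xs → Injective _≡_ _≡_ (lookup xs)
lookup-injective {xs = _ ∷ _} _          {zero}  {zero}  _  = refl
lookup-injective {xs = _ ∷ _} (x∉ ∷ _)  {zero}  {suc j} eq = contradiction eq (All.lookup x∉ (∈-lookup j))
lookup-injective {xs = _ ∷ _} (x∉ ∷ _)  {suc i} {zero}  eq = contradiction (≡.sym eq) (All.lookup x∉ (∈-lookup i))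
lookup-injective {xs = _ ∷ _} (_  ∷ xs!) {suc i} {suc j} eq = cong suc (lookup-injective xs! eq)

enumeration : ∀ {k} (xs : List A) → length xs ≡ k → Unique xs →
  Σ (Fin k → A) λ z →
    Injective _≡_ _≡_ z × (∀ x → (x ∈ₗ xs) ⇔ (∃ λ i → z i ≡ x)) × tabulate z ≡ xs
enumeration xs refl xs! =
  lookup xs , lookup-injective xs! , (λ x → mk⇔ index⁺ index⁻) , tabulate-lookup xs
  where
  index⁺ : ∀ {x} → x ∈ₗ xs → ∃ λ i → lookup xs i ≡ x
  index⁺ x∈xs = index x∈xs , ≡.sym (lookup-index x∈xs)
  index⁻ : ∀ {x} → (∃ λ i → lookup xs i ≡ x) → x ∈ₗ xs
  index⁻ (i , refl) = ∈-lookup i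

module _ (G : Graph n) where

  Covers : List (Fin n) → Subset n → Set
  Covers Q R = ∀ w → w ∈ R → ∃ λ q → q ∈ₗ Q × w ∈ N[ q ] G

  hits : Subset n → Fin n → ℕ
  hits R q = ∣ N[ q ] G ∩ R ∣

  dominates⇒covers : ∀ {Z W} → Dominates G Z W → Covers (elements Z) W
  dominates⇒covers dom w w∈W with z , z∈Z , w∈N[z] ← dom w w∈W = z , ∈-elements⁺ _ z∈Z , w∈N[z]

  covers-resp-↭ : ∀ {Q Q′ R} → Q ↭ Q′ → Covers Q R → Covers Q′ R
  covers-resp-↭ Q↭Q′ cov w w∈R with q , q∈Q , w∈N[q] ← cov w w∈R = q , ∈-resp-↭ Q↭Q′ q∈Q , w∈N[q]

  covers-─ : ∀ {q Q R} → Covers (q ∷ Q) R → Covers Q (R ─ N[ q ] G)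
  covers-─ {q} {R = R} cov w w∈R─N[q] with cov w (p─q⊆p R (N[ q ] G) w∈R─N[q])
  ... | _ , here refl , w∈N[q] = ⊥-elim (x∈p─q⇒x∉q R (N[ q ] G) w∈R─N[q] w∈N[q])
  ... | q′ , there q′∈Q , w∈N[q′] = q′ , q′∈Q , w∈N[q′]

  ∣R∣≤sum-hits : ∀ Q R → Covers Q R → ∣ R ∣ ≤ sum (map (hits R) Q)
  ∣R∣≤sum-hits [] R cov = ≤-reflexive (trans (cong ∣_∣ (Empty-unique uncovered)) (∣⊥∣≡0 n))
    where
    uncovered : Empty R
    uncovered (w , w∈R) with cov w w∈R
    ... | _ , () , _
  ∣R∣≤sum-hits (q ∷ Q) R cov = begin
    ∣ R ∣                                                ≤⟨ ∣p∣≤∣q∩p∣+∣p─q∣ R (N[ q ] G) ⟩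
    hits R q + ∣ R ─ N[ q ] G ∣                          ≤⟨ +-monoʳ-≤ (hits R q) (∣R∣≤sum-hits Q _ (covers-─ cov)) ⟩
    hits R q + sum (map (hits (R ─ N[ q ] G)) Q)         ≤⟨ +-monoʳ-≤ (hits R q) (sum-map-mono-≤ hits-shrink Q) ⟩
    hits R q + sum (map (hits R) Q)                      ∎
    where
    open ≤-Reasoning
    hits-shrink : ∀ q′ → hits (R ─ N[ q ] G) q′ ≤ hits R q′
    hits-shrink q′ = ∣r∩[p─q]∣≤∣r∩p∣ (N[ q′ ] G) R (N[ q ] G)

module Greedy (G : Graph n) (κ μ ν : ℕ) (κμ≤ν : κ * μ ≤ ν) where

  heavy-vertex : ∀ Q R → length Q ≤ κ → Covers G Q R → ν < ∣ R ∣ →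
    ∃₂ λ q Q₁ → Q ↭ q ∷ Q₁ × Strong G 1 κ q R × μ ≤ hits G R q
  heavy-vertex [] R _ cov ν<∣R∣ =
    contradiction (∣R∣≤sum-hits G [] R cov) (<⇒≱ (≤-<-trans z≤n ν<∣R∣))
  heavy-vertex (q₀ ∷ Q₀) R Q≤κ cov ν<∣R∣
    with Q₁ , Q↭ ← ∈⇒↭∷ (argmax∈ (hits G R) q₀ Q₀) =
    q , Q₁ , Q↭ , ≤-trans (≤-reflexive (*-identityˡ ∣ R ∣)) ∣R∣≤κhits , μ≤hits
    where
    q : Fin n
    q = argmax (hits G R) q₀ Q₀
    ∣R∣≤κhits : ∣ R ∣ ≤ κ * hits G R q
    ∣R∣≤κhits = begin
      ∣ R ∣                                 ≤⟨ ∣R∣≤sum-hits G (q₀ ∷ Q₀) R cov ⟩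
      sum (map (hits G R) (q₀ ∷ Q₀))        ≤⟨ sum-map-≤-length*argmax (hits G R) q₀ Q₀ ⟩
      length (q₀ ∷ Q₀) * hits G R q         ≤⟨ *-monoˡ-≤ (hits G R q) Q≤κ ⟩
      κ * hits G R q                        ∎
      where open ≤-Reasoning
    μ≤hits : μ ≤ hits G R q
    μ≤hits = ≮⇒≥ λ hits<μ →
      <⇒≱ ν<∣R∣ (≤-trans ∣R∣≤κhits (≤-trans (*-monoʳ-≤ κ (<⇒≤ hits<μ)) κμ≤ν))

  PseudoCoverOrder : Subset n → List (Fin n) → Set
  PseudoCoverOrder R Q = ∃₂ λ O m → O ↭ Q × m ≤ length O × PCAux G 1 κ μ ν R (take m O)

  greedy : ∀ Q R → length Q ≤ κ → Covers G Q R → PseudoCoverOrder R Q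
  greedy Q R Q≤κ = go (length Q) Q R refl Q≤κ
    where
    go : ∀ k Q R → length Q ≡ k → k ≤ κ → Covers G Q R → PseudoCoverOrder R Q
    go zero    []      R _  _   cov = [] , 0 , ↭-refl , z≤n , ≤-trans (∣R∣≤sum-hits G [] R cov) z≤n
    go zero    (_ ∷ _) R () _   _
    go (suc k) Q       R ∣Q∣≡1+k 1+k≤κ cov with ∣ R ∣ ≤? ν
    ... | yes ∣R∣≤ν = Q , 0 , ↭-refl , z≤n , ∣R∣≤ν
    ... | no ∣R∣≰ν =
      let q , Q₁ , Q↭ , strong , μ≤hits =
            heavy-vertex Q R (≤-trans (≤-reflexive ∣Q∣≡1+k) 1+k≤κ) cov (≰⇒> ∣R∣≰ν)
          O , m , O↭Q₁ , m≤∣O∣ , pc =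
            go k Q₁ (R ─ N[ q ] G) (suc-injective (trans (≡.sym (↭-length Q↭)) ∣Q∣≡1+k))
               (≤-trans (n≤1+n k) 1+k≤κ) (covers-─ G (covers-resp-↭ G Q↭ cov))
      in q ∷ O , suc m , ↭-trans (prep q O↭Q₁) (↭-sym Q↭) , s≤s m≤∣O∣ , strong , μ≤hits , pc

pseudo-cover-ordering : (G : Graph n) (κ μ ν : ℕ) → κ * μ ≤ ν →
  (W Z : Subset n) → ∣ Z ∣ ≡ κ → Dominates G Z W →
  Σ (Fin κ → Fin n) λ z →
    Injective _≡_ _≡_ z × (∀ v → (v ∈ Z) ⇔ (∃ λ i → z i ≡ v)) ×
    Σ ℕ λ m → m ≤ κ × PseudoCover G κ 1 κ μ ν W (take m (tabulate z))
pseudo-cover-ordering G κ μ ν κμ≤ν W Z ∣Z∣≡κ dom =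
  let ∣elements∣≡κ = trans (length-elements Z) ∣Z∣≡κ
      O , m , O↭ , m≤∣O∣ , pc =
        Greedy.greedy G κ μ ν κμ≤ν (elements Z) W (≤-reflexive ∣elements∣≡κ) (dominates⇒covers G dom)
      z , z-injective , z-enumerates , tabulate-z≡O =
        enumeration O (trans (↭-length O↭) ∣elements∣≡κ) (Unique-resp-↭ (↭-sym O↭) (elements-unique Z))
      m≤κ = ≤-trans m≤∣O∣ (≤-reflexive (trans (↭-length O↭) ∣elements∣≡κ))
  in z , z-injective ,
     (λ v → ⇔.trans (∈-elements Z) (⇔.trans (∈-resp-↭⇔ (↭-sym O↭)) (z-enumerates v))) ,
     m , m≤κ ,
     ≤-trans (≤-reflexive (length-take m (tabulate z))) (≤-trans (m⊓n≤m m _) m≤κ) ,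
     subst (λ xs → PCAux G 1 κ μ ν W (take m xs)) (≡.sym tabulate-z≡O) pc

lemma5p3 : ∀ {n} (G : Graph n) (∇₁ ∇₀ ∇ : ℕ) →
    Nabla1≤ G ∇₁ → Nabla0≤ G ∇₀ → ∇₀ ≤ ∇₁ → Nabla1B< G ∇ → ∇ ≤ ∇₁ + 1 →
    let κ = (2 * ∇₀) ⊔ (2 * ∇) in
    let μ = 2 * κ ^ 2 in
    let ν = 2 * κ ^ 3 in
    (W Z : Subset n) → ν ≤ ∣ W ∣ → ∣ Z ∣ ≡ κ → Dominates G Z W →
    Σ (Fin κ → Fin n) λ z →
      Injective _≡_ _≡_ z × (∀ v → (v ∈ Z) ⇔ (∃ λ i → z i ≡ v)) ×
      Σ ℕ λ m → m ≤ κ ×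
        PseudoCover G κ 1 κ μ ν W (take m (tabulate z))
lemma5p3 G _ ∇₀ ∇ _ _ _ _ _ W Z _ =
  pseudo-cover-ordering G κ (2 * κ ^ 2) (2 * κ ^ 3) κμ≤ν W Z
  where
  κ : ℕ
  κ = (2 * ∇₀) ⊔ (2 * ∇)
  κμ≤ν : κ * (2 * κ ^ 2) ≤ 2 * κ ^ 3
  κμ≤ν = ≤-reflexive (x∙yz≈y∙xz *-commutativeSemigroup κ 2 (κ ^ 2))
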